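{- Let $n\ge 3$ and consider $n$ coins placed at the $n$ positions of a circle, each heads-up or tails-up. A move removes a heads-up coin from its position and flips each coin still present in the two positions adjacent (on the circle) to the removed coin's position; vacated positions remain empty, so coins separated by an empty position are not adjacent. Such a circular arrangement is removable (some sequence of moves removes all coins) if and only if the number of heads-up coins is positive and even. -}

module Defs where

open import Data.Nat using (ℕ; zero; suc; _+_; _≡ᵇ_)
open import Data.Bool using (Bool; true; false; _∨_; _∧_; if_then_else_)
open import Data.Fin using (Fin; toℕ)
open import Data.List using (List; map; allFin)
open import Data.Nat.ListAction using (sum)
open import Relation.Binary.PropositionalEquality using (_≡_)

data Side : Set where
  heads tails : Side

data Cell : Set where
  empty : Cell
  coin  : Side → Cell

Config : ℕ → Set
Config n = Fin n → Cell

Arrangement : ℕ → Set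
Arrangement n = Fin n → Side

fill : ∀ {n} → Arrangement n → Config n
fill a i = coin (a i)

succOnCircle : ℕ → ℕ → ℕ → Bool
succOnCircle n a b = ((a + 1) ≡ᵇ b) ∨ (((a + 1) ≡ᵇ n) ∧ (b ≡ᵇ 0))

adjacent : ∀ {n} → Fin n → Fin n → Bool
adjacent {n} i j = succOnCircle n (toℕ i) (toℕ j) ∨ succOnCircle n (toℕ j) (toℕ i)

flipCell : Cell → Cell
flipCell empty = empty
flipCell (coin heads) = coin tails
flipCell (coin tails) = coin heads

move : ∀ {n} → Fin n → Config n → Config n
move {n} i c j =
  if toℕ i ≡ᵇ toℕ j then empty
  else (if adjacent i j then flipCell (c j) else c j)

data Removable {n : ℕ} : Config n → Set where
  done : ∀ {c} → (∀ i → c i ≡ empty) → Removable c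
  step : ∀ {c} (i : Fin n) → c i ≡ coin heads → Removable (move i c) → Removable c

isHeads : Side → ℕ
isHeads heads = 1
isHeads tails = 0

numHeads : ∀ {n} → Arrangement n → ℕ
numHeads {n} a = sum (map (λ i → isHeads (a i)) (allFin n))

{-# OPTIONS --safe #-}
module Submission where

open import Defs
open import Data.Nat using (ℕ; _≤_; _<_)
open import Data.Nat.Divisibility using (_∣_)
open import Data.Product using (_×_)
open import Function.Bundles using (_⇔_)

open import Algebra.Bundles using (Monoid; CommutativeMonoid)
import Algebra.Properties.Monoid.Sum as MonoidSum
import Algebra.Properties.CommutativeMonoid.Sum as CommutativeMonoidSum
open import Data.Bool using (Bool; true; false; _∨_; _∧_; if_then_else_)
open import Data.Bool.Properties
  using (∨-identityʳ; ∨-zeroʳ; ∧-identityʳ; ∧-zeroʳ; if-eta; if-cong; if-cong-else)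
open import Data.Empty using (⊥-elim)
open import Data.Fin using (Fin; zero; suc; toℕ; fromℕ; fromℕ<; inject₁; _≟_)
open import Data.Fin.Induction using (>-weakInduction)
open import Data.Fin.Properties
  using (toℕ-injective; toℕ-fromℕ; toℕ-inject₁; toℕ-fromℕ<; fromℕ≢inject₁; inject₁-injective)
open import Data.Fin.Relation.Unary.Top using (view; ‵fromℕ; ‵inject₁)
open import Data.List using (List; []; _∷_; _++_; map; replicate; tabulate; length)
open import Data.List.Membership.Propositional using (_∈_)
open import Data.List.Membership.Propositional.Properties using (∈-tabulate⁺; ∈-tabulate⁻)
open import Data.List.Properties using (length-map; length-tabulate; map-tabulate)
open import Data.List.Relation.Unary.All using (All; []; _∷_)
open import Data.List.Relation.Unary.Any using (here; there)
open import Data.Nat using (zero; suc; _+_; _≡ᵇ_; z≤n; s≤s; parity)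
open import Data.Nat.Divisibility using (divides; _∣0; ∣-refl; ∣m∣n⇒∣m+n)
import Data.Nat.ListAction as ListAction
import Data.Nat.Properties as ℕ
open import Data.Parity.Base using (Parity; 0ℙ; 1ℙ; _⁻¹) renaming (_+_ to _⊕_; _*_ to _⊛_)
import Data.Parity.Properties as ℙ
open import Data.Product using (∃-syntax; _,_)
open import Data.Vec.Functional using (Vector)
open import Function using (_∘_; id)
open import Function.Bundles using (mk⇔; Equivalence)
open import Function.Definitions using (Injective)
open import Relation.Binary.PropositionalEquality
  using (_≡_; _≢_; _≗_; refl; sym; trans; cong; cong₂; subst; module ≡-Reasoning)
open import Relation.Nullary using (does; yes; no)
open import Relation.Nullary.Decidable using (dec-true; dec-false; does-≡; map′)

-- Let Φ be the parity of the number of heads plus the number of arcs (maximal runs of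
-- adjacent coins), an arc being counted at its first coin. Removing a head at i only
-- changes the contributions of i and of its predecessor, both by whether the
-- predecessor holds a coin, so on a circle of at least three positions Φ is invariant.
-- It is 0 on the empty circle and the parity of the heads on the full one: a removable
-- arrangement has an even number of heads, and a positive one to make a first move.
-- Conversely, rotate a head to the last position and remove it. What is left is a line
-- with an odd number of heads, which is cleared by removing its leftmost head and then
-- the tails before it from right to left; the rest of the line, its first coin flipped,
-- again has an odd number of heads.

-- The circle

prev : ∀ {m} → Fin (suc m) → Fin (suc m)
prev zero    = fromℕ _
prev (suc i) = inject₁ i

prev-injective : ∀ {m} → Injective _≡_ _≡_ (prev {m})
prev-injective {x = zero}  {zero}  _  = refl
prev-injective {x = zero}  {suc j} eq = ⊥-elim (fromℕ≢inject₁ eq)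
prev-injective {x = suc i} {zero}  eq = ⊥-elim (fromℕ≢inject₁ (sym eq))
prev-injective {x = suc i} {suc j} eq = cong suc (inject₁-injective eq)

prev-surjective : ∀ {m} (j : Fin (suc m)) → ∃[ i ] prev i ≡ j
prev-surjective j with view j
... | ‵fromℕ     = zero , refl
... | ‵inject₁ i = suc i , refl

prev-irreflexive : ∀ {m} (i : Fin (2 + m)) → prev i ≢ i
prev-irreflexive zero    ()
prev-irreflexive (suc i) eq = ℕ.m≢1+m+n (toℕ i) (begin
  toℕ i             ≡⟨ toℕ-inject₁ i ⟨
  toℕ (inject₁ i)   ≡⟨ cong toℕ eq ⟩
  suc (toℕ i)       ≡⟨ cong suc (ℕ.+-identityʳ (toℕ i)) ⟨
  suc (toℕ i + 0)   ∎)
  where open ≡-Reasoning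

prev²-irreflexive : ∀ {m} (i : Fin (3 + m)) → prev (prev i) ≢ i
prev²-irreflexive zero          ()
prev²-irreflexive (suc zero)    ()
prev²-irreflexive (suc (suc i)) eq = ℕ.m≢1+m+n (toℕ i) (begin
  toℕ i                       ≡⟨ toℕ-inject₁ i ⟨
  toℕ (inject₁ i)             ≡⟨ toℕ-inject₁ (inject₁ i) ⟨
  toℕ (inject₁ (inject₁ i))   ≡⟨ cong toℕ eq ⟩
  suc (suc (toℕ i))           ≡⟨ cong suc (ℕ.+-comm (toℕ i) 1) ⟨
  suc (toℕ i + 1)             ∎)
  where open ≡-Reasoning

≡ᵇ-toℕ : ∀ {n} (i j : Fin n) → (toℕ i ≡ᵇ toℕ j) ≡ does (i ≟ j)
≡ᵇ-toℕ i j = does-≡ (map′ toℕ-injective (cong toℕ) (toℕ i ℕ.≟ toℕ j)) (i ≟ j)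

does-≟-sym : ∀ {n} (i j : Fin n) → does (i ≟ j) ≡ does (j ≟ i)
does-≟-sym i j = does-≡ (i ≟ j) (map′ sym sym (j ≟ i))

does-≟-injective : ∀ {n} {σ : Fin n → Fin n} → Injective _≡_ _≡_ σ →
                   ∀ i j → does (σ i ≟ σ j) ≡ does (i ≟ j)
does-≟-injective {σ = σ} σ-injective i j = does-≡ (map′ σ-injective (cong σ) (σ i ≟ σ j)) (i ≟ j)

succOnCircle-prev : ∀ {m} (i j : Fin (suc m)) →
                    succOnCircle (suc m) (toℕ i) (toℕ j) ≡ does (i ≟ prev j)
succOnCircle-prev {m} i zero rewrite ℕ.+-comm (toℕ i) 1 = begin
  (toℕ i ≡ᵇ m) ∧ true         ≡⟨ ∧-identityʳ _ ⟩
  toℕ i ≡ᵇ m                  ≡⟨ cong (toℕ i ≡ᵇ_) (toℕ-fromℕ m) ⟨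
  toℕ i ≡ᵇ toℕ (fromℕ m)      ≡⟨ ≡ᵇ-toℕ i (fromℕ m) ⟩
  does (i ≟ fromℕ m)          ∎
  where open ≡-Reasoning
succOnCircle-prev {m} i (suc j) rewrite ℕ.+-comm (toℕ i) 1 = begin
  (toℕ i ≡ᵇ toℕ j) ∨ ((toℕ i ≡ᵇ m) ∧ false)  ≡⟨ cong ((toℕ i ≡ᵇ toℕ j) ∨_) (∧-zeroʳ _) ⟩
  (toℕ i ≡ᵇ toℕ j) ∨ false                    ≡⟨ ∨-identityʳ _ ⟩
  toℕ i ≡ᵇ toℕ j                              ≡⟨ cong (toℕ i ≡ᵇ_) (toℕ-inject₁ j) ⟨
  toℕ i ≡ᵇ toℕ (inject₁ j)                    ≡⟨ ≡ᵇ-toℕ i (inject₁ j) ⟩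
  does (i ≟ inject₁ j)                        ∎
  where open ≡-Reasoning

adjacent-prev : ∀ {m} (i j : Fin (suc m)) → adjacent i j ≡ does (i ≟ prev j) ∨ does (j ≟ prev i)
adjacent-prev i j = cong₂ _∨_ (succOnCircle-prev i j) (succOnCircle-prev j i)

adjacent-prev-prev : ∀ {m} (i j : Fin (suc m)) → adjacent (prev i) (prev j) ≡ adjacent i j
adjacent-prev-prev i j = begin
  adjacent (prev i) (prev j)                                      ≡⟨ adjacent-prev (prev i) (prev j) ⟩
  does (prev i ≟ prev (prev j)) ∨ does (prev j ≟ prev (prev i))
    ≡⟨ cong₂ _∨_ (prev-≟ i (prev j)) (prev-≟ j (prev i)) ⟩
  does (i ≟ prev j) ∨ does (j ≟ prev i)                          ≡⟨ adjacent-prev i j ⟨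
  adjacent i j                                                    ∎
  where
  open ≡-Reasoning
  prev-≟ = does-≟-injective prev-injective

adjacent-toPrev : ∀ {m} (i : Fin (suc m)) → adjacent i (prev i) ≡ true
adjacent-toPrev i = trans (adjacent-prev i (prev i))
  (trans (cong (does (i ≟ prev (prev i)) ∨_) (dec-true (prev i ≟ prev i) refl)) (∨-zeroʳ _))

adjacent-fromPrev : ∀ {m} {i j : Fin (suc m)} → prev j ≡ i → adjacent i j ≡ true
adjacent-fromPrev {j = j} refl = trans (adjacent-prev (prev j) j)
  (cong (_∨ does (j ≟ prev (prev j))) (dec-true (prev j ≟ prev j) refl))

adjacent-far : ∀ {m} {i j : Fin (suc m)} → prev j ≢ i → j ≢ prev i → adjacent i j ≡ false
adjacent-far {i = i} {j} prevj≢i j≢previ = trans (adjacent-prev i j)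
  (cong₂ _∨_ (dec-false (i ≟ prev j) (prevj≢i ∘ sym)) (dec-false (j ≟ prev i) j≢previ))

adjacent-irreflexive : ∀ {m} (i : Fin (2 + m)) → adjacent i i ≡ false
adjacent-irreflexive i = adjacent-far (prev-irreflexive i) (prev-irreflexive i ∘ sym)

move-≟ : ∀ {n} (i : Fin n) (c : Config n) j →
         move i c j ≡ (if does (i ≟ j) then empty else if adjacent i j then flipCell (c j) else c j)
move-≟ i c j = if-cong (≡ᵇ-toℕ i j)

move-self : ∀ {n} (i : Fin n) (c : Config n) → move i c i ≡ empty
move-self i c = trans (move-≟ i c i) (if-cong (dec-true (i ≟ i) refl))

move-other : ∀ {n} {i j : Fin n} (c : Config n) → i ≢ j →
             move i c j ≡ (if adjacent i j then flipCell (c j) else c j)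
move-other {i = i} {j} c i≢j = trans (move-≟ i c j) (if-cong (dec-false (i ≟ j) i≢j))

move-toPrev : ∀ {m} (c : Config (2 + m)) i → move i c (prev i) ≡ flipCell (c (prev i))
move-toPrev c i = trans (move-other c (prev-irreflexive i ∘ sym)) (if-cong (adjacent-toPrev i))

move-fromPrev : ∀ {m} (c : Config (2 + m)) {i j} → prev j ≡ i → move i c j ≡ flipCell (c j)
move-fromPrev c {j = j} refl =
  trans (move-other c (prev-irreflexive j)) (if-cong (adjacent-fromPrev {i = prev j} {j} refl))

move-far : ∀ {m} (c : Config (suc m)) {i j} → i ≢ j → prev j ≢ i → j ≢ prev i → move i c j ≡ c j
move-far c i≢j prevj≢i j≢previ = trans (move-other c i≢j) (if-cong (adjacent-far prevj≢i j≢previ))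

move-≗ : ∀ {n} (i : Fin n) {c d : Config n} → c ≗ d → move i c ≗ move i d
move-≗ i c≗d j =
  cong (λ v → if toℕ i ≡ᵇ toℕ j then empty else if adjacent i j then flipCell v else v) (c≗d j)

Removable-≗ : ∀ {n} {c d : Config n} → c ≗ d → Removable c → Removable d
Removable-≗ c≗d (done vacant)         = done λ j → trans (sym (c≗d j)) (vacant j)
Removable-≗ c≗d (step i cᵢ removable) =
  step i (trans (sym (c≗d i)) cᵢ) (Removable-≗ (move-≗ i c≗d) removable)

Removable-reindex : ∀ {n} (σ : Fin n → Fin n) → Injective _≡_ _≡_ σ → (∀ j → ∃[ i ] σ i ≡ j) →
                    (∀ i j → adjacent (σ i) (σ j) ≡ adjacent i j) →
                    ∀ {c d} → d ≗ c ∘ σ → Removable d → Removable c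
Removable-reindex σ σ-injective σ-surjective σ-adjacent {c} d≗cσ (done vacant) = done λ j →
  let i , σi≡j = σ-surjective j in subst (λ j → c j ≡ empty) σi≡j (trans (sym (d≗cσ i)) (vacant i))
Removable-reindex σ σ-injective σ-surjective σ-adjacent {c} {d} d≗cσ (step i dᵢ removable) =
  step (σ i) (trans (sym (d≗cσ i)) dᵢ)
    (Removable-reindex σ σ-injective σ-surjective σ-adjacent
      (λ j → trans (move-≗ i d≗cσ j) (move-σ j)) removable)
  where
  move-σ : move i (c ∘ σ) ≗ move (σ i) c ∘ σ
  move-σ j = cong₂ (λ b b′ → if b then empty else if b′ then flipCell (c (σ j)) else c (σ j))
    (trans (≡ᵇ-toℕ i j) (trans (sym (does-≟-injective σ-injective i j)) (sym (≡ᵇ-toℕ (σ i) (σ j)))))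
    (sym (σ-adjacent i j))

Removable-prev : ∀ {m} {c : Config (suc m)} → Removable (c ∘ prev) → Removable c
Removable-prev = Removable-reindex prev prev-injective prev-surjective adjacent-prev-prev (λ _ → refl)

module PointMass {c ℓ} (M : Monoid c ℓ) where
  open Monoid M using (Carrier; _≈_; ∙-congˡ; identityˡ; identityʳ) renaming (ε to 0#; trans to ≈-trans)
  open MonoidSum M using (sum; sum-replicate-zero)

  pointAt : ∀ {n} → Fin n → Carrier → Vector Carrier n
  pointAt k x j = if does (j ≟ k) then x else 0#

  sum-pointAt : ∀ {n} (k : Fin n) x → sum (pointAt k x) ≈ x
  sum-pointAt {suc n} zero    x = ≈-trans (∙-congˡ (sum-replicate-zero n)) (identityʳ x)
  sum-pointAt {suc n} (suc k) x = ≈-trans (identityˡ _) (sum-pointAt k x)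

module Rotation {c ℓ} (M : CommutativeMonoid c ℓ) where
  open CommutativeMonoid M using (Carrier; _≈_; comm) renaming (trans to ≈-trans; sym to ≈-sym)
  open CommutativeMonoidSum M using (sum; sum-init-last)

  sum-prev : ∀ {m} (f : Vector Carrier (suc m)) → sum (f ∘ prev) ≈ sum f
  sum-prev f = ≈-trans (comm _ _) (≈-sym (sum-init-last f))

open CommutativeMonoidSum ℙ.+-0-commutativeMonoid
  using (sum-syntax; ∑-distrib-+; sum-cong-≗; sum-init-last; sum-replicate-zero)
open PointMass ℙ.+-0-monoid using (pointAt; sum-pointAt)
open Rotation ℙ.+-0-commutativeMonoid using (sum-prev)

sum-init≡sum⊕last : ∀ {m} (f : Fin (suc m) → Parity) →
                    ∑[ x < m ] f (inject₁ x) ≡ ∑[ j < suc m ] f j ⊕ f (fromℕ m)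
sum-init≡sum⊕last {m} f = begin
  ∑ᵢₙᵢₜ                    ≡⟨ ℙ.+-identityʳ ∑ᵢₙᵢₜ ⟨
  ∑ᵢₙᵢₜ ⊕ 0ℙ               ≡⟨ cong (∑ᵢₙᵢₜ ⊕_) (ℙ.p+p≡0ℙ fₗ) ⟨
  ∑ᵢₙᵢₜ ⊕ (fₗ ⊕ fₗ)        ≡⟨ ℙ.+-assoc ∑ᵢₙᵢₜ fₗ fₗ ⟨
  ∑ᵢₙᵢₜ ⊕ fₗ ⊕ fₗ          ≡⟨ cong (_⊕ fₗ) (sum-init-last f) ⟨
  ∑[ j < suc m ] f j ⊕ fₗ  ∎
  where
  open ≡-Reasoning
  ∑ᵢₙᵢₜ = ∑[ x < m ] f (inject₁ x)
  fₗ = f (fromℕ m)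

-- The invariant

occupied : Cell → Parity
occupied empty    = 0ℙ
occupied (coin _) = 1ℙ

headUp : Cell → Parity
headUp empty    = 0ℙ
headUp (coin s) = parity (isHeads s)

-- An arc is counted at its first coin: an occupied position whose predecessor is vacant.
contribution : Cell → Cell → Parity
contribution previous current = headUp current ⊕ (occupied current ⊛ occupied previous ⁻¹)

headParity : ∀ {n} → Arrangement n → Fin n → Parity
headParity a j = parity (isHeads (a j))

headsPlusArcs : ∀ {m} → Config (suc m) → Parity
headsPlusArcs {m} c = ∑[ j < suc m ] contribution (c (prev j)) (c j)

occupied-flipCell : ∀ v → occupied (flipCell v) ≡ occupied v
occupied-flipCell empty        = refl
occupied-flipCell (coin heads) = refl
occupied-flipCell (coin tails) = refl

occupied-move : ∀ {n} {i j : Fin n} (c : Config n) → i ≢ j → occupied (move i c j) ≡ occupied (c j)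
occupied-move {i = i} {j} c i≢j rewrite move-other c i≢j with adjacent i j
... | true  = occupied-flipCell (c j)
... | false = refl

contribution-congˡ : ∀ {u u′} v → occupied u ≡ occupied u′ → contribution u v ≡ contribution u′ v
contribution-congˡ v = cong (λ o → headUp v ⊕ (occupied v ⊛ o ⁻¹))

contribution-heads : ∀ u → contribution u (coin heads) ≡ occupied u
contribution-heads empty    = refl
contribution-heads (coin _) = refl

contribution-flipped : ∀ u v → contribution u (flipCell v) ⊕ contribution u v ≡ occupied v
contribution-flipped empty    empty        = refl
contribution-flipped empty    (coin heads) = refl
contribution-flipped empty    (coin tails) = refl
contribution-flipped (coin _) empty        = refl
contribution-flipped (coin _) (coin heads) = refl
contribution-flipped (coin _) (coin tails) = refl

contribution-afterRemovedHead : ∀ v → contribution empty (flipCell v) ⊕ contribution (coin heads) v ≡ 0ℙ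
contribution-afterRemovedHead empty        = refl
contribution-afterRemovedHead (coin heads) = refl
contribution-afterRemovedHead (coin tails) = refl

module HeadRemoval {k} (c : Config (3 + k)) {i : Fin (3 + k)} (cᵢ : c i ≡ coin heads) where
  open ≡-Reasoning

  private
    after before change : Fin (3 + k) → Parity
    after j = contribution (move i c (prev j)) (move i c j)
    before j = contribution (c (prev j)) (c j)
    change j = after j ⊕ before j

    x : Parity
    x = occupied (c (prev i))

    change-self : change i ≡ x
    change-self = begin
      change i
        ≡⟨ cong₂ (λ v w → contribution (move i c (prev i)) v ⊕ contribution (c (prev i)) w)
                 (move-self i c) cᵢ ⟩
      contribution (c (prev i)) (coin heads)
        ≡⟨ contribution-heads (c (prev i)) ⟩
      x ∎

    change-prev : change (prev i) ≡ x
    change-prev = begin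
      change (prev i)
        ≡⟨ cong (λ v → contribution (move i c (prev (prev i))) v ⊕ before (prev i)) (move-toPrev c i) ⟩
      contribution (move i c (prev (prev i))) (flipCell (c (prev i))) ⊕ before (prev i)
        ≡⟨ cong (_⊕ before (prev i)) (contribution-congˡ (flipCell (c (prev i)))
                                         (occupied-move c (prev²-irreflexive i ∘ sym))) ⟩
      contribution (c (prev (prev i))) (flipCell (c (prev i))) ⊕ before (prev i)
        ≡⟨ contribution-flipped (c (prev (prev i))) (c (prev i)) ⟩
      x ∎

    change-next : ∀ {j} → prev j ≡ i → change j ≡ 0ℙ
    change-next {j} prevj≡i = begin
      change j
        ≡⟨ cong₂ (λ u w → contribution u (move i c j) ⊕ contribution w (c j))
                 (trans (cong (move i c) prevj≡i) (move-self i c)) (trans (cong c prevj≡i) cᵢ) ⟩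
      contribution empty (move i c j) ⊕ contribution (coin heads) (c j)
        ≡⟨ cong (λ v → contribution empty v ⊕ contribution (coin heads) (c j)) (move-fromPrev c prevj≡i) ⟩
      contribution empty (flipCell (c j)) ⊕ contribution (coin heads) (c j)
        ≡⟨ contribution-afterRemovedHead (c j) ⟩
      0ℙ ∎

    change-far : ∀ {j} → j ≢ i → prev j ≢ i → j ≢ prev i → change j ≡ 0ℙ
    change-far {j} j≢i prevj≢i j≢previ = begin
      change j
        ≡⟨ cong (λ v → contribution (move i c (prev j)) v ⊕ before j)
                (move-far c (j≢i ∘ sym) prevj≢i j≢previ) ⟩
      contribution (move i c (prev j)) (c j) ⊕ before j
        ≡⟨ cong (_⊕ before j) (contribution-congˡ (c j) (occupied-move c (prevj≢i ∘ sym))) ⟩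
      before j ⊕ before j
        ≡⟨ ℙ.p+p≡0ℙ (before j) ⟩
      0ℙ ∎

    change≡pointAt : ∀ j → change j ≡ pointAt i x j ⊕ pointAt (prev i) x j
    change≡pointAt j with j ≟ i
    ... | yes refl = begin
      change i                  ≡⟨ change-self ⟩
      x                         ≡⟨ ℙ.+-identityʳ x ⟨
      x ⊕ 0ℙ                    ≡⟨ cong (λ b → x ⊕ (if b then x else 0ℙ))
                                        (dec-false (i ≟ prev i) (prev-irreflexive i ∘ sym)) ⟨
      x ⊕ pointAt (prev i) x i  ∎
    ... | no j≢i with j ≟ prev i
    ...   | yes refl = change-prev
    ...   | no j≢previ with prev j ≟ i
    ...     | yes prevj≡i = change-next prevj≡i
    ...     | no prevj≢i  = change-far j≢i prevj≢i j≢previ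

  headsPlusArcs-move : headsPlusArcs (move i c) ≡ headsPlusArcs c
  headsPlusArcs-move = ℙ.+-cancelʳ-≡ (headsPlusArcs c) _ _ (begin
    headsPlusArcs (move i c) ⊕ headsPlusArcs c
      ≡⟨ ∑-distrib-+ after before ⟨
    ∑[ j < 3 + k ] change j
      ≡⟨ sum-cong-≗ change≡pointAt ⟩
    ∑[ j < 3 + k ] (pointAt i x j ⊕ pointAt (prev i) x j)
      ≡⟨ ∑-distrib-+ (pointAt i x) (pointAt (prev i) x) ⟩
    ∑[ j < 3 + k ] pointAt i x j ⊕ ∑[ j < 3 + k ] pointAt (prev i) x j
      ≡⟨ cong₂ _⊕_ (sum-pointAt i x) (sum-pointAt (prev i) x) ⟩
    x ⊕ x
      ≡⟨ ℙ.p+p≡0ℙ x ⟩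
    0ℙ
      ≡⟨ ℙ.p+p≡0ℙ (headsPlusArcs c) ⟨
    headsPlusArcs c ⊕ headsPlusArcs c ∎)

open HeadRemoval using (headsPlusArcs-move)

Removable⇒headsPlusArcs≡0ℙ : ∀ {k} {c : Config (3 + k)} → Removable c → headsPlusArcs c ≡ 0ℙ
Removable⇒headsPlusArcs≡0ℙ {k} (done vacant) =
  trans (sum-cong-≗ λ j → cong₂ contribution (vacant (prev j)) (vacant j)) (sum-replicate-zero (3 + k))
Removable⇒headsPlusArcs≡0ℙ {c = c} (step i cᵢ removable) =
  trans (sym (headsPlusArcs-move c cᵢ)) (Removable⇒headsPlusArcs≡0ℙ removable)

headsPlusArcs-fill : ∀ {m} (a : Arrangement (suc m)) → headsPlusArcs (fill a) ≡ ∑[ j < suc m ] headParity a j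
headsPlusArcs-fill a = sum-cong-≗ λ j → ℙ.+-identityʳ (headParity a j)

headCount : List Side → ℕ
headCount xs = ListAction.sum (map isHeads xs)

numHeads≡headCount : ∀ {n} (a : Arrangement n) → numHeads a ≡ headCount (tabulate a)
numHeads≡headCount a = cong ListAction.sum (trans (map-tabulate id (isHeads ∘ a)) (sym (map-tabulate a isHeads)))

headCount>0⇒heads∈ : ∀ xs → 0 < headCount xs → heads ∈ xs
headCount>0⇒heads∈ (heads ∷ _)  _        = here refl
headCount>0⇒heads∈ (tails ∷ xs) positive = there (headCount>0⇒heads∈ xs positive)

heads∈⇒headCount>0 : ∀ {xs} → heads ∈ xs → 0 < headCount xs
heads∈⇒headCount>0 (here refl)              = s≤s z≤n
heads∈⇒headCount>0 {y ∷ _} (there heads∈xs) =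
  ℕ.<-≤-trans (heads∈⇒headCount>0 heads∈xs) (ℕ.m≤n+m _ (isHeads y))

numHeads-positive⇔ : ∀ {n} (a : Arrangement n) → 0 < numHeads a ⇔ (∃[ i ] a i ≡ heads)
numHeads-positive⇔ a rewrite numHeads≡headCount a = mk⇔
  (λ positive → let i , heads≡aᵢ = ∈-tabulate⁻ (headCount>0⇒heads∈ (tabulate a) positive)
                in i , sym heads≡aᵢ)
  (λ (i , aᵢ) → heads∈⇒headCount>0 (subst (_∈ tabulate a) aᵢ (∈-tabulate⁺ i)))

parity-suc : ∀ n → parity (suc n) ≡ parity n ⁻¹
parity-suc n = sym (ℙ.⁻¹-selfInverse (ℙ.suc-homo-⁻¹ n))

parity≡0ℙ⇔2∣ : ∀ n → parity n ≡ 0ℙ ⇔ 2 ∣ n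
parity≡0ℙ⇔2∣ n = mk⇔ (even n) λ where (divides q refl) → trans (ℙ.*-homo-* q 2) (ℙ.*-zeroʳ (parity q))
  where
  even : ∀ n → parity n ≡ 0ℙ → 2 ∣ n
  even zero          _         = 2 ∣0
  even (suc (suc n)) parity≡0ℙ = ∣m∣n⇒∣m+n ∣-refl (even n parity≡0ℙ)

parity-headCount : ∀ {n} (a : Fin n → Side) → parity (headCount (tabulate a)) ≡ ∑[ i < n ] headParity a i
parity-headCount {zero}  a = refl
parity-headCount {suc n} a = trans (ℙ.+-homo-+ (isHeads (a zero)) (headCount (tabulate (a ∘ suc))))
                                   (cong (headParity a zero ⊕_) (parity-headCount (a ∘ suc)))

numHeads-even⇔ : ∀ {n} (a : Arrangement n) → 2 ∣ numHeads a ⇔ ∑[ i < n ] headParity a i ≡ 0ℙ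
numHeads-even⇔ a = mk⇔
  (λ even → trans (sym parity-numHeads) (Equivalence.from (parity≡0ℙ⇔2∣ _) even))
  (λ even → Equivalence.to (parity≡0ℙ⇔2∣ _) (trans parity-numHeads even))
  where parity-numHeads = trans (cong parity (numHeads≡headCount a)) (parity-headCount a)

Removable-fill⇒heads : ∀ {m} {a : Arrangement (suc m)} → Removable (fill a) → ∃[ i ] a i ≡ heads
Removable-fill⇒heads (done vacant) with () ← vacant zero
Removable-fill⇒heads (step i aᵢ _) = i , coin-injective aᵢ
  where
  coin-injective : ∀ {s t} → coin s ≡ coin t → s ≡ t
  coin-injective refl = refl

-- Coins on a line

cellAt : List Cell → ℕ → Cell
cellAt []       _       = empty
cellAt (v ∷ _)  zero    = v
cellAt (_ ∷ cs) (suc t) = cellAt cs t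

cellAt-beyond : ∀ cs {t} → length cs ≤ t → cellAt cs t ≡ empty
cellAt-beyond []       _           = refl
cellAt-beyond (_ ∷ cs) (s≤s len≤t) = cellAt-beyond cs len≤t

cellAt-coin⇒< : ∀ cs {t s} → cellAt cs t ≡ coin s → t < length cs
cellAt-coin⇒< []       ()
cellAt-coin⇒< (_ ∷ cs) {zero}  _  = s≤s z≤n
cellAt-coin⇒< (_ ∷ cs) {suc t} eq = s≤s (cellAt-coin⇒< cs eq)

cellAt-vacant : ∀ {cs} → All (_≡ empty) cs → ∀ t → cellAt cs t ≡ empty
cellAt-vacant []            _       = refl
cellAt-vacant (v≡empty ∷ _) zero    = v≡empty
cellAt-vacant (_ ∷ vacant)  (suc t) = cellAt-vacant vacant t

cellAt-tabulate : ∀ {n} (f : Fin n → Side) (x : Fin n) → cellAt (map coin (tabulate f)) (toℕ x) ≡ coin (f x)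
cellAt-tabulate f zero    = refl
cellAt-tabulate f (suc x) = cellAt-tabulate (f ∘ suc) x

flipFirst : List Cell → List Cell
flipFirst []       = []
flipFirst (v ∷ cs) = flipCell v ∷ cs

lineMove : ℕ → List Cell → List Cell
lineMove _             []       = []
lineMove zero          (_ ∷ cs) = empty ∷ flipFirst cs
lineMove (suc zero)    (v ∷ cs) = flipCell v ∷ lineMove zero cs
lineMove (suc (suc r)) (v ∷ cs) = v ∷ lineMove (suc r) cs

length-lineMove : ∀ r cs → length (lineMove r cs) ≡ length cs
length-lineMove _             []          = refl
length-lineMove zero          (_ ∷ [])    = refl
length-lineMove zero          (_ ∷ _ ∷ _) = refl
length-lineMove (suc zero)    (_ ∷ cs)    = cong suc (length-lineMove zero cs)
length-lineMove (suc (suc r)) (_ ∷ cs)    = cong suc (length-lineMove (suc r) cs)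

cellAt-lineMove : ∀ r cs t → cellAt (lineMove r cs) t ≡
  (if r ≡ᵇ t then empty else if (r + 1 ≡ᵇ t) ∨ (t + 1 ≡ᵇ r) then flipCell (cellAt cs t) else cellAt cs t)
cellAt-lineMove r             []          t             = sym (trans (if-cong-else (r ≡ᵇ t) (if-eta _)) (if-eta _))
cellAt-lineMove zero          (_ ∷ _)     zero          = refl
cellAt-lineMove zero          (_ ∷ [])    (suc zero)    = refl
cellAt-lineMove zero          (_ ∷ [])    (suc (suc t)) = refl
cellAt-lineMove zero          (_ ∷ _ ∷ _) (suc zero)    = refl
cellAt-lineMove zero          (_ ∷ _ ∷ _) (suc (suc t)) = refl
cellAt-lineMove (suc zero)    (_ ∷ _)     zero          = refl
cellAt-lineMove (suc zero)    (_ ∷ cs)    (suc t)       = cellAt-lineMove zero cs t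
cellAt-lineMove (suc (suc r)) (_ ∷ _)     zero          = refl
cellAt-lineMove (suc (suc r)) (_ ∷ cs)    (suc t)       = cellAt-lineMove (suc r) cs t

data LineRemovable : List Cell → Set where
  done : ∀ {cs} → All (_≡ empty) cs → LineRemovable cs
  step : ∀ {cs} r → cellAt cs r ≡ coin heads → LineRemovable (lineMove r cs) → LineRemovable cs

LineRemovable-empty∷ : ∀ {cs} → LineRemovable cs → LineRemovable (empty ∷ cs)
LineRemovable-empty∷ (done vacant)              = done (refl ∷ vacant)
LineRemovable-empty∷ (step zero    h removable) = step 1 h (LineRemovable-empty∷ removable)
LineRemovable-empty∷ (step (suc r) h removable) = step (2 + r) h (LineRemovable-empty∷ removable)

LineRemovable-empties++ : ∀ k {cs} → LineRemovable cs → LineRemovable (replicate k empty ++ cs)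
LineRemovable-empties++ zero    removable = removable
LineRemovable-empties++ (suc k) removable = LineRemovable-empty∷ (LineRemovable-empties++ k removable)

replicate-++-∷ : ∀ {a} {A : Set a} k (x : A) xs → replicate k x ++ x ∷ xs ≡ x ∷ replicate k x ++ xs
replicate-++-∷ zero    x xs = refl
replicate-++-∷ (suc k) x xs = cong (x ∷_) (replicate-++-∷ k x xs)

tailsRun : ℕ → List Cell
tailsRun k = replicate k (coin tails)

cellAt-tailsRun : ∀ k v cs → cellAt (tailsRun k ++ v ∷ cs) k ≡ v
cellAt-tailsRun zero    v cs = refl
cellAt-tailsRun (suc k) v cs = cellAt-tailsRun k v cs

lineMove-tailsRun : ∀ k cs → lineMove (suc k) (tailsRun (suc k) ++ coin heads ∷ cs)
                             ≡ tailsRun k ++ coin heads ∷ empty ∷ flipFirst cs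
lineMove-tailsRun zero    cs = refl
lineMove-tailsRun (suc k) cs = cong (coin tails ∷_) (lineMove-tailsRun k cs)

-- Each tail is turned up by the removal of its right neighbour.
LineRemovable-tailsRun : ∀ k cs → LineRemovable (replicate (suc k) empty ++ flipFirst cs) →
                         LineRemovable (tailsRun k ++ coin heads ∷ cs)
LineRemovable-tailsRun zero    cs removable = step 0 refl removable
LineRemovable-tailsRun (suc k) cs removable =
  step (suc k) (cellAt-tailsRun (suc k) (coin heads) cs)
    (subst LineRemovable (sym (lineMove-tailsRun k cs))
      (LineRemovable-tailsRun k (empty ∷ flipFirst cs)
        (subst LineRemovable (sym (cong (empty ∷_) (replicate-++-∷ k empty (flipFirst cs)))) removable)))

mutual
  LineRemovable-odd∷ : ∀ k y ys → parity (headCount (y ∷ ys)) ≡ 1ℙ →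
                       LineRemovable (tailsRun k ++ coin y ∷ map coin ys)
  LineRemovable-odd∷ k heads ys odd =
    LineRemovable-tailsRun k (map coin ys) (LineRemovable-empties++ (suc k)
      (LineRemovable-flipFirst ys (ℙ.⁻¹-injective (trans (sym (parity-suc (headCount ys))) odd))))
  LineRemovable-odd∷ k tails []       ()
  LineRemovable-odd∷ k tails (y ∷ ys) odd =
    subst LineRemovable (sym (replicate-++-∷ k (coin tails) _)) (LineRemovable-odd∷ (suc k) y ys odd)

  LineRemovable-flipFirst : ∀ ys → parity (headCount ys) ≡ 0ℙ → LineRemovable (flipFirst (map coin ys))
  LineRemovable-flipFirst []           _    = done []
  LineRemovable-flipFirst (heads ∷ ys) even =
    LineRemovable-odd∷ 0 tails ys (ℙ.⁻¹-injective (trans (sym (parity-suc (headCount ys))) even))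
  LineRemovable-flipFirst (tails ∷ ys) even =
    LineRemovable-odd∷ 0 heads ys (trans (parity-suc (headCount ys)) (cong _⁻¹ even))

LineRemovable-odd : ∀ xs → parity (headCount xs) ≡ 1ℙ → LineRemovable (map coin xs)
LineRemovable-odd []       ()
LineRemovable-odd (x ∷ xs) odd = LineRemovable-odd∷ 0 x xs odd

toCircle : ∀ {n} → List Cell → Config n
toCircle cs j = cellAt cs (toℕ j)

succOnCircle-noWrap : ∀ n a b → a + 1 ≢ n → succOnCircle n a b ≡ (a + 1 ≡ᵇ b)
succOnCircle-noWrap n a b a+1≢n =
  trans (cong (λ w → (a + 1 ≡ᵇ b) ∨ (w ∧ (b ≡ᵇ 0))) (dec-false (a + 1 ℕ.≟ n) a+1≢n)) (∨-identityʳ _)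

flipIf-cong : ∀ v {b b′} → (∀ s → v ≡ coin s → b ≡ b′) →
              (if b then flipCell v else v) ≡ (if b′ then flipCell v else v)
flipIf-cong empty    {b} {b′} _  = trans (if-eta b) (sym (if-eta b′))
flipIf-cong (coin s)           eq = if-cong (eq s refl)

Removable-fromLine : ∀ {n cs} → length cs < n → LineRemovable cs → Removable (toCircle {n} cs)
Removable-fromLine _ (done vacant) = done (cellAt-vacant vacant ∘ toℕ)
Removable-fromLine {n} {cs} len<n (step r cs[r] removable) =
  step r′ (trans (cong (cellAt cs) (toℕ-fromℕ< r<n)) cs[r])
    (Removable-≗ (λ j → agree (toℕ j))
      (Removable-fromLine (subst (_< n) (sym (length-lineMove r cs)) len<n) removable))
  where
  r<len = cellAt-coin⇒< cs cs[r]
  r<n = ℕ.<-trans r<len len<n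
  r′ = fromℕ< r<n

  noWrap : ∀ {t} → t < length cs → t + 1 ≢ n
  noWrap {t} t<len t+1≡n = ℕ.<-irrefl t+1≡n (subst (_< n) (ℕ.+-comm 1 t) (ℕ.≤-<-trans t<len len<n))

  agree : ∀ t → cellAt (lineMove r cs) t ≡
    (if toℕ r′ ≡ᵇ t then empty else
     if succOnCircle n (toℕ r′) t ∨ succOnCircle n t (toℕ r′) then flipCell (cellAt cs t) else cellAt cs t)
  agree t rewrite toℕ-fromℕ< r<n =
    trans (cellAt-lineMove r cs t) (if-cong-else (r ≡ᵇ t) (flipIf-cong (cellAt cs t) λ _ cs[t] →
      sym (cong₂ _∨_ (succOnCircle-noWrap n r t (noWrap r<len))
                     (succOnCircle-noWrap n t r (noWrap (cellAt-coin⇒< cs cs[t]))))))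

-- Clearing the circle

bit : Bool → Parity
bit b = if b then 1ℙ else 0ℙ

sum-adjacent : ∀ {k} (i : Fin (3 + k)) → ∑[ j < 3 + k ] bit (adjacent i j) ≡ 0ℙ
sum-adjacent {k} i = begin
  ∑[ j < 3 + k ] bit (adjacent i j)
    ≡⟨ sum-cong-≗ neighbours ⟩
  ∑[ j < 3 + k ] (pointAt i 1ℙ (prev j) ⊕ pointAt (prev i) 1ℙ j)
    ≡⟨ ∑-distrib-+ (pointAt i 1ℙ ∘ prev) (pointAt (prev i) 1ℙ) ⟩
  ∑[ j < 3 + k ] pointAt i 1ℙ (prev j) ⊕ ∑[ j < 3 + k ] pointAt (prev i) 1ℙ j
    ≡⟨ cong₂ _⊕_ (trans (sum-prev (pointAt i 1ℙ)) (sum-pointAt i 1ℙ)) (sum-pointAt (prev i) 1ℙ) ⟩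
  1ℙ ⊕ 1ℙ ∎
  where
  open ≡-Reasoning
  neighbours : ∀ j → bit (adjacent i j) ≡ pointAt i 1ℙ (prev j) ⊕ pointAt (prev i) 1ℙ j
  neighbours j rewrite adjacent-prev i j | does-≟-sym i (prev j) with prev j ≟ i | j ≟ prev i
  ... | yes refl | yes j≡prev²j = ⊥-elim (prev²-irreflexive j (sym j≡prev²j))
  ... | yes _    | no _         = refl
  ... | no _     | yes _        = refl
  ... | no _     | no _         = refl

flipSide : Side → Side
flipSide heads = tails
flipSide tails = heads

flipSideIf : Bool → Side → Side
flipSideIf b s = if b then flipSide s else s

coin-flipSideIf : ∀ b s → coin (flipSideIf b s) ≡ (if b then flipCell (coin s) else coin s)
coin-flipSideIf true  heads = refl
coin-flipSideIf true  tails = refl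
coin-flipSideIf false _     = refl

parity-isHeads-flipSideIf : ∀ b s → parity (isHeads (flipSideIf b s)) ≡ parity (isHeads s) ⊕ bit b
parity-isHeads-flipSideIf true  heads = refl
parity-isHeads-flipSideIf true  tails = refl
parity-isHeads-flipSideIf false heads = refl
parity-isHeads-flipSideIf false tails = refl

remainingLine : ∀ {m} → Arrangement (suc m) → List Side
remainingLine {m} b = tabulate λ x → flipSideIf (adjacent (fromℕ m) (inject₁ x)) (b (inject₁ x))

length-remainingLine : ∀ {m} (b : Arrangement (suc m)) → length (map coin (remainingLine b)) ≡ m
length-remainingLine b = trans (length-map coin (remainingLine b)) (length-tabulate _)

toCircle-remainingLine : ∀ {m} (b : Arrangement (suc m)) →
                         toCircle (map coin (remainingLine b)) ≗ move (fromℕ m) (fill b)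
toCircle-remainingLine {m} b j with view j
... | ‵fromℕ =
  trans (cellAt-beyond line (ℕ.≤-reflexive (trans (length-remainingLine b) (sym (toℕ-fromℕ m)))))
        (sym (move-self (fromℕ m) (fill b)))
  where line = map coin (remainingLine b)
... | ‵inject₁ x = begin
  cellAt line (toℕ (inject₁ x))     ≡⟨ cong (cellAt line) (toℕ-inject₁ x) ⟩
  cellAt line (toℕ x)               ≡⟨ cellAt-tabulate _ x ⟩
  coin (flipSideIf (adjacent (fromℕ m) (inject₁ x)) s)
    ≡⟨ coin-flipSideIf (adjacent (fromℕ m) (inject₁ x)) s ⟩
  (if adjacent (fromℕ m) (inject₁ x) then flipCell (coin s) else coin s)
    ≡⟨ move-other (fill b) fromℕ≢inject₁ ⟨
  move (fromℕ m) (fill b) (inject₁ x) ∎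
  where
  open ≡-Reasoning
  line = map coin (remainingLine b)
  s = b (inject₁ x)

parity-remainingLine : ∀ {k} (b : Arrangement (3 + k)) →
  parity (headCount (remainingLine b)) ≡ ∑[ j < 3 + k ] headParity b j ⊕ headParity b (fromℕ (2 + k))
parity-remainingLine {k} b = begin
  parity (headCount (remainingLine b))
    ≡⟨ parity-headCount (λ x → flipSideIf (adjacent last (inject₁ x)) (b (inject₁ x))) ⟩
  ∑[ x < m ] parity (isHeads (flipSideIf (adjacent last (inject₁ x)) (b (inject₁ x))))
    ≡⟨ sum-cong-≗ (λ x → parity-isHeads-flipSideIf (adjacent last (inject₁ x)) (b (inject₁ x))) ⟩
  ∑[ x < m ] (headParity b (inject₁ x) ⊕ bit (adjacent last (inject₁ x)))
    ≡⟨ ∑-distrib-+ (headParity b ∘ inject₁) (bit ∘ adjacent last ∘ inject₁) ⟩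
  ∑[ x < m ] headParity b (inject₁ x) ⊕ ∑[ x < m ] bit (adjacent last (inject₁ x))
    ≡⟨ cong₂ _⊕_ (sum-init≡sum⊕last (headParity b)) (sum-init≡sum⊕last (bit ∘ adjacent last)) ⟩
  (∑[ j < suc m ] headParity b j ⊕ headParity b last)
    ⊕ (∑[ j < suc m ] bit (adjacent last j) ⊕ bit (adjacent last last))
    ≡⟨ cong (λ p → (∑[ j < suc m ] headParity b j ⊕ headParity b last) ⊕ p)
            (cong₂ _⊕_ (sum-adjacent last) (cong bit (adjacent-irreflexive last))) ⟩
  (∑[ j < suc m ] headParity b j ⊕ headParity b last) ⊕ 0ℙ
    ≡⟨ ℙ.+-identityʳ _ ⟩
  ∑[ j < suc m ] headParity b j ⊕ headParity b last ∎
  where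
  open ≡-Reasoning
  m = 2 + k
  last = fromℕ m

Removable-headAtLast : ∀ {k} (b : Arrangement (3 + k)) → b (fromℕ (2 + k)) ≡ heads →
                       ∑[ j < 3 + k ] headParity b j ≡ 0ℙ → Removable (fill b)
Removable-headAtLast b headAtLast evenHeads =
  step _ (cong coin headAtLast)
    (Removable-≗ (toCircle-remainingLine b)
      (Removable-fromLine (ℕ.≤-reflexive (cong suc (length-remainingLine b)))
        (LineRemovable-odd (remainingLine b)
          (trans (parity-remainingLine b) (cong₂ _⊕_ evenHeads (cong (parity ∘ isHeads) headAtLast))))))

-- A rotation carries a head at inject₁ i to suc i, so downward induction reaches the last position.
Removable-headAt : ∀ {k} (i : Fin (3 + k)) (a : Arrangement (3 + k)) → a i ≡ heads →
                   ∑[ j < 3 + k ] headParity a j ≡ 0ℙ → Removable (fill a)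
Removable-headAt {k} = >-weakInduction P Removable-headAtLast rotate
  where
  P : Fin (3 + k) → Set
  P i = ∀ a → a i ≡ heads → ∑[ j < 3 + k ] headParity a j ≡ 0ℙ → Removable (fill a)

  rotate : ∀ i → P (suc i) → P (inject₁ i)
  rotate i removable a headAt evenHeads =
    Removable-prev (removable (a ∘ prev) headAt (trans (sum-prev (headParity a)) evenHeads))

proposition4 : (n : ℕ) → 3 ≤ n → (a : Arrangement n) →
    Removable (fill a) ⇔ (0 < numHeads a × 2 ∣ numHeads a)
proposition4 1 (s≤s ()) _
proposition4 2 (s≤s (s≤s ())) _
proposition4 (suc (suc (suc k))) _ a = mk⇔
  (λ removable → Equivalence.from (numHeads-positive⇔ a) (Removable-fill⇒heads removable)
               , Equivalence.from (numHeads-even⇔ a)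
                   (trans (sym (headsPlusArcs-fill a)) (Removable⇒headsPlusArcs≡0ℙ removable)))
  (λ (positive , even) → let i , aᵢ = Equivalence.to (numHeads-positive⇔ a) positive
                         in Removable-headAt i a aᵢ (Equivalence.to (numHeads-even⇔ a) even))
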